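{- Let $n\ge 1$ and $e=e_1\cdots e_n\in \mathbf{I}_n(0012)$. If $\textsc{srpt}(e)=k$, then $e_i=i-1$ for all $1\le i\le k+1$.
   Context: An inversion sequence of length $n$ is a sequence $e=e_1\cdots e_n$ of integers with $0\le e_i\le i-1$. The reduction of a word replaces each occurrence of the $k$-th smallest distinct entry by $k-1$; $e$ contains a pattern $p$ if some subsequence (entries at increasing positions) has reduction $p$, and avoids $p$ otherwise. $\mathbf{I}_n(0012)$ is the set of inversion sequences of length $n$ avoiding $0012$. For $e\in\mathbf{I}_n(0012)$, $\mathcal{R}(e)=\{m:\exists\, i\ne j,\ e_i=e_j=m\}$ is the set of values appearing more than once in $e$, and $\textsc{srpt}(e)=\min\mathcal{R}(e)$; for the unique sequence $01\cdots(n-1)$ (where $\mathcal{R}=\emptyset$) one sets $\textsc{srpt}(01\cdots(n-1))=n-1$. -}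

module Defs where

open import Data.Nat using (ℕ; zero; suc; _≤_; _<_; _<?_; _≟_; _∸_)
open import Data.Fin using (Fin; toℕ)
open import Data.List using (List; length; lookup; map; filter; deduplicate)
open import Data.List.Relation.Binary.Sublist.Propositional using (_⊆_)
open import Data.Product using (Σ; ∃; _×_)
open import Data.Sum using (_⊎_)
open import Relation.Binary.PropositionalEquality using (_≡_; _≢_)
open import Relation.Nullary using (¬_)

-- A word is a list of naturals; positions are 0-indexed (position i : Fin (length w)
-- holds the paper's entry e_{i+1}).

IsInvSeq : ℕ → List ℕ → Set
IsInvSeq n e = (length e ≡ n) × ((i : Fin (length e)) → lookup e i ≤ toℕ i)

reduce : List ℕ → List ℕ
reduce w = map (λ x → length (filter (_<? x) (deduplicate _≟_ w))) w

Contains : List ℕ → List ℕ → Set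
Contains w p = Σ (List ℕ) (λ s → (s ⊆ w) × (reduce s ≡ p))

Avoids : List ℕ → List ℕ → Set
Avoids w p = ¬ Contains w p

p0012 : List ℕ
p0012 = 0 Data.List.∷ 0 Data.List.∷ 1 Data.List.∷ 2 Data.List.∷ Data.List.[]

InI0012 : ℕ → List ℕ → Set
InI0012 n e = IsInvSeq n e × Avoids e p0012

InR : List ℕ → ℕ → Set
InR e m = Σ (Fin (length e)) λ i → Σ (Fin (length e)) λ j →
  (i ≢ j) × (lookup e i ≡ m) × (lookup e j ≡ m)

-- srpt(e) = k for e of length n: k = min R(e) if R(e) ≠ ∅, and k = n-1 if R(e) = ∅
-- (for 0012-avoiding inversion sequences R(e) = ∅ exactly for e = 01⋯(n-1)).
SrptIs : ℕ → List ℕ → ℕ → Set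
SrptIs n e k =
  (InR e k × ((m : ℕ) → InR e m → k ≤ m))
  ⊎ (((m : ℕ) → ¬ InR e m) × (k ≡ n ∸ 1))

-- Strong induction on i ≤ k + 1: if v = e_i were below i - 1, then e_{v+1} = v by induction,
-- so v occurs twice although v < k = srpt(e), contradicting minimality.
module Submission where

open import Defs
open import Data.Nat using (ℕ; _≤_; _<_; _<?_)
open import Data.Nat.Properties using (≤-antisym; ≮⇒≥; <⇒≱; <⇒≤; <-≤-trans; <-irrefl)
open import Data.Nat.Induction using (<-wellFounded)
open import Data.Fin using (Fin; toℕ; fromℕ<)
open import Data.Fin.Properties using (toℕ<n; toℕ-fromℕ<)
open import Data.List using (List; length; lookup)
open import Data.Product using (_,_)
open import Data.Sum using (inj₁; inj₂)
open import Data.Empty using (⊥-elim)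
open import Induction.WellFounded using (Acc; acc)
open import Relation.Nullary using (yes; no; contradiction)
open import Relation.Binary.PropositionalEquality using (_≡_; _≢_; refl; sym; trans; cong; subst)

RepeatsAtLeast : List ℕ → ℕ → Set
RepeatsAtLeast e k = (m : ℕ) → InR e m → k ≤ m

srpt-repeatsAtLeast : ∀ n e {k} → SrptIs n e k → RepeatsAtLeast e k
srpt-repeatsAtLeast _ _ (inj₁ (_ , minimal))   = minimal
srpt-repeatsAtLeast _ _ (inj₂ (noRepeat , _)) m m∈R = ⊥-elim (noRepeat m m∈R)

module _ (e : List ℕ) (bounded : (i : Fin (length e)) → lookup e i ≤ toℕ i)
         {k : ℕ} (repeats≥k : RepeatsAtLeast e k) where

  lookup≡toℕ-acc : (i : Fin (length e)) → Acc _<_ (toℕ i) → toℕ i ≤ k → lookup e i ≡ toℕ i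
  lookup≡toℕ-acc i (acc rec) i≤k with lookup e i <? toℕ i
  ... | no  v≮i = ≤-antisym (bounded i) (≮⇒≥ v≮i)
  ... | yes v<i = contradiction (repeats≥k v (i , j , i≢j , refl , trans e[j]≡j j≡v)) (<⇒≱ v<k)
    where
    v : ℕ
    v = lookup e i
    v<k : v < k
    v<k = <-≤-trans v<i i≤k
    v<len : v < length e
    v<len = <-≤-trans v<i (<⇒≤ (toℕ<n i))
    j : Fin (length e)
    j = fromℕ< v<len
    j≡v : toℕ j ≡ v
    j≡v = toℕ-fromℕ< v<len
    e[j]≡j : lookup e j ≡ toℕ j
    e[j]≡j = lookup≡toℕ-acc j (rec (subst (_< toℕ i) (sym j≡v) v<i)) (subst (_≤ k) (sym j≡v) (<⇒≤ v<k))
    i≢j : i ≢ j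
    i≢j i≡j = <-irrefl (trans (sym j≡v) (cong toℕ (sym i≡j))) v<i

  lookup≡toℕ : (i : Fin (length e)) → toℕ i ≤ k → lookup e i ≡ toℕ i
  lookup≡toℕ i = lookup≡toℕ-acc i (<-wellFounded (toℕ i))

lemma2p1 : (n : ℕ) → 1 ≤ n → (e : List ℕ) → InI0012 n e → (k : ℕ) → SrptIs n e k →
    (i : Fin (length e)) → toℕ i ≤ k → lookup e i ≡ toℕ i
lemma2p1 n _ e ((_ , bounded) , _) _ srpt = lookup≡toℕ e bounded (srpt-repeatsAtLeast n e srpt)
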